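{- Let $m,n,r$ be positive integers with $r\le m$. Then $\mathrm{Occ}(m,n,r)$ is less than or equal to the largest integer $p$ for which there exist nonnegative integers $x_1,x_2,\dots,x_{n^{m-r}}$ satisfying \[ p=\sum_{i=1}^{n^{m-r}} i\,x_i,\qquad \sum_{i=1}^{n^{m-r}} x_i\le n^r,\qquad p\le \binom{m}{r}x_1 . \]
   Context: Let $(A,\le)$ be a partially ordered set of functions on a set $X$. For $S\subseteq X$ and $f\in A$, $f$ is called Occam on $S$ (and $S$ Occam for $f$) if $f$ is the least element of $\{g\in A \mid g|_S=f|_S\}$. The radius $R(f)$ of $f\in A$ is $\min\{|S| : S\subseteq X,\ S \text{ is Occam for } f\}$ if this is finite, and $\infty$ otherwise. When the partial order is equality, $f$ is Occam on $S$ exactly when $f$ is the only function in $A$ that agrees with $f$ on $S$. For positive integers $m,n,r$, $\mathrm{Occ}(m,n,r)$ denotes the maximum possible value of $|A|$, where $|X|=m$, $|Y|=n$, and $A$ is a set of functions from $X$ to $Y$, ordered by equality, such that $R(f)\le r$ for every $f\in A$. -}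

module Defs where

open import Data.Nat using (ℕ; suc; _+_; _*_; _∸_; _^_; _≤_)
open import Data.Nat.Combinatorics using (_C_)
open import Data.Fin using (Fin; toℕ)
open import Data.Fin.Subset using (Subset; _∈_; ∣_∣)
open import Data.Vec using (Vec; lookup)
open import Data.List using (List; map; allFin; length)
open import Data.Nat.ListAction using (sum)
open import Data.List.Membership.Propositional renaming (_∈_ to _∈ₗ_)
open import Data.List.Relation.Unary.Unique.Propositional using (Unique)
open import Data.Product using (Σ; _×_; ∃)
open import Relation.Binary.PropositionalEquality using (_≡_)

-- A function X → Y with X = Fin m, Y = Fin n is represented by its table
-- Vec (Fin n) m (so equality of functions is propositional equality of tables).
Fun : ℕ → ℕ → Set
Fun m n = Vec (Fin n) m

AgreeOn : ∀ {m n} → Subset m → Fun m n → Fun m n → Set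
AgreeOn S g f = ∀ x → x ∈ S → lookup g x ≡ lookup f x

-- f is Occam on S w.r.t. the family A ordered by equality:
-- f is the least element of {g ∈ A | g|_S = f|_S}, i.e. f belongs to it
-- and f ≡ g for every g in it.
Occam : ∀ {m n} → List (Fun m n) → Subset m → Fun m n → Set
Occam A S f = (f ∈ₗ A) × (∀ g → g ∈ₗ A → AgreeOn S g f → f ≡ g)

-- R(f) ≤ r : some Occam set S for f has |S| ≤ r
-- (R(f) is the minimum of such |S|, or ∞ if there is none).
RadiusAtMost : ∀ {m n} → List (Fun m n) → Fun m n → ℕ → Set
RadiusAtMost A f r = Σ (Subset _) λ S → Occam A S f × ∣ S ∣ ≤ r

-- Feasibility of p: nonnegative integers x_1..x_N (N = n^(m-r)), indexed here
-- by i : Fin N standing for index toℕ i + 1, with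
-- p = Σ i x_i, Σ x_i ≤ n^r, p ≤ C(m,r) x_1.
Feasible : ℕ → ℕ → ℕ → ℕ → Set
Feasible m n r p =
  Σ (Fin (n ^ (m ∸ r)) → ℕ) λ x →
    (p ≡ sum (map (λ i → suc (toℕ i) * x i) (allFin (n ^ (m ∸ r)))))
    × (sum (map x (allFin (n ^ (m ∸ r)))) ≤ n ^ r)
    × (Σ (Fin (n ^ (m ∸ r))) λ i₁ → (toℕ i₁ ≡ 0) × (p ≤ (m C r) * x i₁))

-- Every Occam set of f ∈ A extends to a set T of size r, and f is then determined within A
-- by its restriction f|T. Averaging over the C(m,r) sets of size r yields one T determining
-- s ≥ |A| / C(m,r) members of A. These s members have distinct restrictions to T, and every
-- other member f is fixed by the pair (f|T, f|∁T), whose first entry is none of those s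
-- restrictions; so the q remaining members satisfy q ≤ n^(m-r) (n^r - s). Splitting q greedily
-- into at most n^r - s parts of size at most n^(m-r) and adding s parts of size 1, the
-- multiplicities x of the part sizes witness feasibility of p = s + q = |A|, with x₁ ≥ s.
module Submission where

open import Defs
open import Data.Nat using (ℕ; zero; suc; _+_; _*_; _∸_; _^_; _≤_; _<_; z≤n; s≤s; s≤s⁻¹; _≤?_; >-nonZero)
open import Data.Nat.Properties hiding (_≟_)
open import Data.Nat.ListAction using (sum)
open import Data.Nat.ListAction.Properties using (sum-++)
open import Data.Nat.Combinatorics using (_C_; nCk+nC[k+1]≡[n+1]C[k+1]; nCk≡nC[n∸k]; nCn≡1)
open import Data.List
  using (List; []; _∷_; _++_; length; map; filter; allFin; tabulate; replicate; cartesianProductWith; cartesianProduct)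
open import Data.List.Properties
  using (length-map; length-++; length-replicate; length-tabulate; length-removeAt′; map-++; map-replicate; map-tabulate; filter-all)
open import Data.List.Membership.Propositional using (_∈_)
open import Data.List.Membership.Propositional.Properties
  using (∈-map⁺; ∈-map⁻; ∈-++⁺ˡ; ∈-++⁺ʳ; ∈-++⁻; ∈-allFin; ∈-filter⁻;
         ∈-cartesianProductWith⁺; ∈-cartesianProduct⁺; ∈-cartesianProduct⁻)
open import Data.List.Relation.Unary.Any using (here; there; _─_)
open import Data.List.Relation.Unary.All using (All)
import Data.List.Relation.Unary.All as All
import Data.List.Relation.Unary.All.Properties as All
import Data.List.Relation.Unary.AllPairs as AllPairs
open import Data.List.Relation.Unary.Unique.Propositional using (Unique)
open import Data.List.Relation.Unary.Unique.Propositional.Properties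
  using (map⁺; allFin⁺; cartesianProductWith⁺; cartesianProduct⁺; filter⁺; ++⁺)
open import Data.List.Relation.Binary.Subset.Propositional using (_⊆_)
open import Data.List.Relation.Binary.Disjoint.Propositional using (Disjoint)
open import Data.List.Relation.Binary.Sublist.Propositional.Properties using (length-mono-≤; filter-⊆)
import Data.List.Relation.Binary.Sublist.Propositional.Properties as Sublist
open import Data.Fin using (Fin; zero; suc; toℕ; fromℕ; fromℕ<; _≟_)
open import Data.Fin.Properties using (toℕ-fromℕ; toℕ-fromℕ<)
open import Data.Fin.Subset using (Subset; inside; outside; ∣_∣; ∁; ⊤; ⊥) renaming (_∈_ to _∈ₛ_; _⊆_ to _⊆ₛ_)
open import Data.Fin.Subset.Properties using (⊆⊤; ∣⊤∣≡n; ∣⊥∣≡0; ∣∁p∣≡n∸∣p∣)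
open import Data.Vec using (Vec; []; _∷_; here; there; lookup)
open import Data.Vec.Properties using (∷-injective; ≡-dec)
open import Data.Bool using (true; false)
open import Data.Product using (Σ; _×_; _,_; proj₁; proj₂; ∃-syntax; Σ-syntax)
open import Data.Sum using (inj₁; inj₂)
open import Relation.Nullary using (¬_; does; yes; no; contradiction; _→-dec_)
open import Relation.Unary using (Decidable)
open import Relation.Unary.Properties using (∁?)
open import Relation.Binary.PropositionalEquality
open import Function using (_∘_; id)
open import Algebra.Properties.CommutativeMonoid.Sum +-0-commutativeMonoid
  using (sum-syntax; ∑-distrib-+; sum-cong-≗; sum-replicate-zero)

module _ {A : Set} where

  ∈-─ : ∀ {x y : A} {xs} (x∈xs : x ∈ xs) → y ∈ xs → y ≢ x → y ∈ (xs ─ x∈xs)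
  ∈-─ (here refl)  (here refl)  y≢x = contradiction refl y≢x
  ∈-─ (here refl)  (there y∈xs) _   = y∈xs
  ∈-─ (there _)    (here refl)  _   = here refl
  ∈-─ (there x∈xs) (there y∈xs) y≢x = there (∈-─ x∈xs y∈xs y≢x)

  unique∧⊆⇒length≤ : ∀ {xs ys : List A} → Unique xs → xs ⊆ ys → length xs ≤ length ys
  unique∧⊆⇒length≤ {[]}     _              _      = z≤n
  unique∧⊆⇒length≤ {x ∷ xs} {ys} (x≢xs AllPairs.∷ xs!) xs⊆ys = begin
    suc (length xs)          ≤⟨ s≤s (unique∧⊆⇒length≤ xs! xs⊆ys─x) ⟩
    suc (length (ys ─ x∈ys)) ≡⟨ length-removeAt′ ys _ ⟨
    length ys                ∎
    where
    open ≤-Reasoning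
    x∈ys = xs⊆ys (here refl)
    xs⊆ys─x : xs ⊆ (ys ─ x∈ys)
    xs⊆ys─x y∈xs = ∈-─ x∈ys (xs⊆ys (there y∈xs)) (λ y≡x → All.lookup x≢xs y∈xs (sym y≡x))

  map⁺-injectiveOn : ∀ {B : Set} {f : A → B} {xs} → Unique xs →
    (∀ {x y} → x ∈ xs → y ∈ xs → f x ≡ f y → x ≡ y) → Unique (map f xs)
  map⁺-injectiveOn {xs = []}     _                    _   = AllPairs.[]
  map⁺-injectiveOn {xs = x ∷ xs} (x≢xs AllPairs.∷ xs!) inj =
    All.map⁺ (All.tabulate (λ y∈xs fx≡fy → All.lookup x≢xs y∈xs (inj (here refl) (there y∈xs) fx≡fy)))
    AllPairs.∷ map⁺-injectiveOn xs! (λ x∈xs y∈xs → inj (there x∈xs) (there y∈xs))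

  length-filter+length-filter-∁ : ∀ {P : A → Set} (P? : Decidable P) xs →
    length (filter P? xs) + length (filter (∁? P?) xs) ≡ length xs
  length-filter+length-filter-∁ P? []       = refl
  length-filter+length-filter-∁ P? (x ∷ xs) with does (P? x)
  ... | true  = cong suc (length-filter+length-filter-∁ P? xs)
  ... | false = trans (+-suc _ _) (cong suc (length-filter+length-filter-∁ P? xs))

  length-filter-filter : ∀ {P Q : A → Set} (P? : Decidable P) (Q? : Decidable Q) xs →
    length (filter P? (filter Q? xs)) ≤ length (filter P? xs)
  length-filter-filter P? Q? xs = length-mono-≤ (Sublist.filter⁺ P? P? (λ { refl → id }) (filter-⊆ Q? xs))

length-cartesianProductWith : ∀ {A B C : Set} (f : A → B → C) xs ys →
  length (cartesianProductWith f xs ys) ≡ length xs * length ys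
length-cartesianProductWith f []       ys = refl
length-cartesianProductWith f (x ∷ xs) ys = begin
  length (map (f x) ys ++ cartesianProductWith f xs ys)         ≡⟨ length-++ (map (f x) ys) ⟩
  length (map (f x) ys) + length (cartesianProductWith f xs ys) ≡⟨ cong₂ _+_ (length-map (f x) ys) (length-cartesianProductWith f xs ys) ⟩
  length ys + length xs * length ys                             ∎
  where open ≡-Reasoning

module _ {K X : Set} {P : K → X → Set} (P? : ∀ k → Decidable (P k)) where

  -- By induction on ks: compare the class of the first k with the class found for the
  -- elements of xs that it misses.
  ∃-large-class : ∀ {k₀} ks xs → k₀ ∈ ks → (∀ {x} → x ∈ xs → ∃[ k ] k ∈ ks × P k x) →
    ∃[ k ] k ∈ ks × length xs ≤ length ks * length (filter (P? k) xs)
  ∃-large-class (k ∷ []) xs _ cover =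
    k , here refl , ≤-reflexive (sym (trans (*-identityˡ _) (cong length (filter-all (P? k) (All.tabulate Pk)))))
    where
    Pk : ∀ {x} → x ∈ xs → P k x
    Pk x∈xs with cover x∈xs
    ... | _ , here refl , Pkx = Pkx
  ∃-large-class (k ∷ ks@(_ ∷ _)) xs _ cover = heavier (∃-large-class ks xs′ (here refl) cover′)
    where
    xs′ : List X
    xs′ = filter (∁? (P? k)) xs

    count : K → ℕ
    count k′ = length (filter (P? k′) xs)

    cover′ : ∀ {x} → x ∈ xs′ → ∃[ k′ ] k′ ∈ ks × P k′ x
    cover′ x∈xs′ with x∈xs , ¬Pkx ← ∈-filter⁻ (∁? (P? k)) x∈xs′ with cover x∈xs
    ... | _  , here refl     , Pkx  = contradiction Pkx ¬Pkx
    ... | k′ , there k′∈ks , Pk′x = k′ , k′∈ks , Pk′x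

    split : ∀ {j} → length xs′ ≤ length ks * length (filter (P? j) xs′) →
      length xs ≤ count k + length ks * count j
    split {j} bound = begin
      length xs                                        ≡⟨ length-filter+length-filter-∁ (P? k) xs ⟨
      count k + length xs′                             ≤⟨ +-monoʳ-≤ (count k) bound ⟩
      count k + length ks * length (filter (P? j) xs′) ≤⟨ +-monoʳ-≤ (count k)
                                                            (*-monoʳ-≤ (length ks) (length-filter-filter (P? j) (∁? (P? k)) xs)) ⟩
      count k + length ks * count j                    ∎
      where open ≤-Reasoning

    heavier : ∃[ j ] j ∈ ks × length xs′ ≤ length ks * length (filter (P? j) xs′) →
      ∃[ k′ ] k′ ∈ k ∷ ks × length xs ≤ length (k ∷ ks) * count k′
    heavier (j , j∈ks , bound) with count k ≤? count j
    ... | yes k≤j = j , there j∈ks , ≤-trans (split bound) (+-monoˡ-≤ _ k≤j)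
    ... | no  k≰j = k , here refl ,
      ≤-trans (split bound) (+-monoʳ-≤ (count k) (*-monoʳ-≤ (length ks) (≰⇒≥ k≰j)))

module _ {n : ℕ} where

  allVecs : ∀ k → List (Vec (Fin n) k)
  allVecs zero    = [] ∷ []
  allVecs (suc k) = cartesianProductWith _∷_ (allFin n) (allVecs k)

  ∈-allVecs : ∀ {k} (v : Vec (Fin n) k) → v ∈ allVecs k
  ∈-allVecs []      = here refl
  ∈-allVecs (x ∷ v) = ∈-cartesianProductWith⁺ _∷_ (∈-allFin x) (∈-allVecs v)

  allVecs⁺ : ∀ k → Unique (allVecs k)
  allVecs⁺ zero    = All.[] AllPairs.∷ AllPairs.[]
  allVecs⁺ (suc k) = cartesianProductWith⁺ _∷_ ∷-injective (allFin⁺ n) (allVecs⁺ k)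

  length-allVecs : ∀ k → length (allVecs k) ≡ n ^ k
  length-allVecs zero    = refl
  length-allVecs (suc k) = trans (length-cartesianProductWith _∷_ (allFin n) (allVecs k))
                                 (cong₂ _*_ (length-tabulate {n = n} id) (length-allVecs k))

module _ {A : Set} where

  restrict : ∀ {m} (T : Subset m) → Vec A m → Vec A ∣ T ∣
  restrict []            []      = []
  restrict (inside  ∷ T) (x ∷ u) = x ∷ restrict T u
  restrict (outside ∷ T) (x ∷ u) = restrict T u

  restrict-agrees : ∀ {m} (T : Subset m) {u v : Vec A m} → restrict T u ≡ restrict T v →
    ∀ x → x ∈ₛ T → lookup u x ≡ lookup v x
  restrict-agrees (inside  ∷ T) {_ ∷ _} {_ ∷ _} eq zero    here        = proj₁ (∷-injective eq)
  restrict-agrees (inside  ∷ T) {_ ∷ _} {_ ∷ _} eq (suc x) (there x∈T) =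
    restrict-agrees T (proj₂ (∷-injective eq)) x x∈T
  restrict-agrees (outside ∷ T) {_ ∷ _} {_ ∷ _} eq (suc x) (there x∈T) = restrict-agrees T eq x x∈T

  restrict-∁-injective : ∀ {m} (T : Subset m) {u v : Vec A m} →
    restrict T u ≡ restrict T v → restrict (∁ T) u ≡ restrict (∁ T) v → u ≡ v
  restrict-∁-injective []            {[]}    {[]}    _  _  = refl
  restrict-∁-injective (inside  ∷ T) {_ ∷ _} {_ ∷ _} eq eq′
    with refl , eq ← ∷-injective eq = cong (_ ∷_) (restrict-∁-injective T eq eq′)
  restrict-∁-injective (outside ∷ T) {_ ∷ _} {_ ∷ _} eq eq′
    with refl , eq′ ← ∷-injective eq′ = cong (_ ∷_) (restrict-∁-injective T eq eq′)

subsetsOfSize : (m r : ℕ) → List (Subset m)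
subsetsOfSize zero    zero    = [] ∷ []
subsetsOfSize zero    (suc r) = []
subsetsOfSize (suc m) zero    = map (outside ∷_) (subsetsOfSize m zero)
subsetsOfSize (suc m) (suc r) =
  map (outside ∷_) (subsetsOfSize m (suc r)) ++ map (inside ∷_) (subsetsOfSize m r)

length-subsetsOfSize : ∀ m r → length (subsetsOfSize m r) ≡ m C r
length-subsetsOfSize zero    zero    = refl
length-subsetsOfSize zero    (suc r) = refl
length-subsetsOfSize (suc m) zero    = begin
  length (map (outside ∷_) (subsetsOfSize m zero)) ≡⟨ length-map _ (subsetsOfSize m zero) ⟩
  length (subsetsOfSize m zero)                    ≡⟨ length-subsetsOfSize m zero ⟩
  m C 0                                            ≡⟨ nC0≡1 m ⟩
  1                                                ≡⟨ nC0≡1 (suc m) ⟨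
  suc m C 0                                        ∎
  where
  open ≡-Reasoning
  nC0≡1 : ∀ n → n C 0 ≡ 1
  nC0≡1 n = trans (nCk≡nC[n∸k] {0} {n} z≤n) (nCn≡1 n)
length-subsetsOfSize (suc m) (suc r) = begin
  length (map (outside ∷_) (subsetsOfSize m (suc r)) ++ map (inside ∷_) (subsetsOfSize m r))
    ≡⟨ length-++ (map (outside ∷_) (subsetsOfSize m (suc r))) ⟩
  length (map (outside ∷_) (subsetsOfSize m (suc r))) + length (map (inside ∷_) (subsetsOfSize m r))
    ≡⟨ cong₂ _+_ (length-map _ (subsetsOfSize m (suc r))) (length-map _ (subsetsOfSize m r)) ⟩
  length (subsetsOfSize m (suc r)) + length (subsetsOfSize m r)
    ≡⟨ cong₂ _+_ (length-subsetsOfSize m (suc r)) (length-subsetsOfSize m r) ⟩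
  m C suc r + m C r ≡⟨ +-comm (m C suc r) (m C r) ⟩
  m C r + m C suc r ≡⟨ nCk+nC[k+1]≡[n+1]C[k+1] m r ⟩
  suc m C suc r     ∎
  where open ≡-Reasoning

∈-subsetsOfSize⁺ : ∀ {m r : ℕ} (T : Subset m) → ∣ T ∣ ≡ r → T ∈ subsetsOfSize m r
∈-subsetsOfSize⁺ {r = zero}  []            _  = here refl
∈-subsetsOfSize⁺ {r = zero}  (outside ∷ T) eq = ∈-map⁺ (outside ∷_) (∈-subsetsOfSize⁺ T eq)
∈-subsetsOfSize⁺ {r = suc r} (outside ∷ T) eq = ∈-++⁺ˡ (∈-map⁺ (outside ∷_) (∈-subsetsOfSize⁺ T eq))
∈-subsetsOfSize⁺ {suc m} {suc r} (inside ∷ T) eq =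
  ∈-++⁺ʳ (map (outside ∷_) (subsetsOfSize m (suc r)))
         (∈-map⁺ (inside ∷_) (∈-subsetsOfSize⁺ T (suc-injective eq)))

∈-subsetsOfSize⁻ : ∀ {m r : ℕ} {T : Subset m} → T ∈ subsetsOfSize m r → ∣ T ∣ ≡ r
∈-subsetsOfSize⁻ {zero}  {zero}  {[]} (here refl) = refl
∈-subsetsOfSize⁻ {suc m} {zero}  T∈
  with _ , T∈′ , refl ← ∈-map⁻ (outside ∷_) T∈ = ∈-subsetsOfSize⁻ T∈′
∈-subsetsOfSize⁻ {suc m} {suc r} T∈ with ∈-++⁻ (map (outside ∷_) (subsetsOfSize m (suc r))) T∈
... | inj₁ T∈ˡ with _ , T∈′ , refl ← ∈-map⁻ (outside ∷_) T∈ˡ = ∈-subsetsOfSize⁻ T∈′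
... | inj₂ T∈ʳ with _ , T∈′ , refl ← ∈-map⁻ (inside ∷_) T∈ʳ = cong suc (∈-subsetsOfSize⁻ T∈′)

∃-⊇-ofSize : ∀ {m r} (S : Subset m) → ∣ S ∣ ≤ r → r ≤ m → ∃[ T ] S ⊆ₛ T × ∣ T ∣ ≡ r
∃-⊇-ofSize [] z≤n z≤n = [] , id , refl
∃-⊇-ofSize (inside ∷ S) (s≤s ∣S∣≤r) (s≤s r≤m)
  with T , S⊆T , ∣T∣≡r ← ∃-⊇-ofSize S ∣S∣≤r r≤m =
  inside ∷ T , (λ { here → here ; (there x∈S) → there (S⊆T x∈S) }) , cong suc ∣T∣≡r
∃-⊇-ofSize {suc m} {r} (outside ∷ S) ∣S∣≤r r≤1+m with r ≤? m
... | yes r≤m with T , S⊆T , ∣T∣≡r ← ∃-⊇-ofSize S ∣S∣≤r r≤m =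
  outside ∷ T , (λ { (there x∈S) → there (S⊆T x∈S) }) , ∣T∣≡r
... | no r≰m = ⊤ , ⊆⊤ , trans (∣⊤∣≡n (suc m)) (≤-antisym (≰⇒> r≰m) r≤1+m)

∃-∈-subsetsOfSize : ∀ {m r} → r ≤ m → ∃[ T ] T ∈ subsetsOfSize m r
∃-∈-subsetsOfSize {m} r≤m with T , _ , ∣T∣≡r ← ∃-⊇-ofSize ⊥ (≤-trans (≤-reflexive (∣⊥∣≡0 m)) z≤n) r≤m =
  T , ∈-subsetsOfSize⁺ T ∣T∣≡r

sum-replicate : ∀ n x → sum (replicate n x) ≡ n * x
sum-replicate zero    x = refl
sum-replicate (suc n) x = cong (x +_) (sum-replicate n x)

sum-map-const-1 : ∀ {A : Set} (xs : List A) → sum (map (λ _ → 1) xs) ≡ length xs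
sum-map-const-1 []       = refl
sum-map-const-1 (_ ∷ xs) = cong suc (sum-map-const-1 xs)

sum-tabulate : ∀ {N} (g : Fin N → ℕ) → sum (tabulate g) ≡ ∑[ i < N ] g i
sum-tabulate {zero}  g = refl
sum-tabulate {suc N} g = cong (g zero +_) (sum-tabulate (g ∘ suc))

sum-map-allFin : ∀ {N} (g : Fin N → ℕ) → sum (map g (allFin N)) ≡ ∑[ i < N ] g i
sum-map-allFin g = trans (cong sum (map-tabulate id g)) (sum-tabulate g)

δ : ∀ {N} → Fin N → Fin N → ℕ
δ zero    zero    = 1
δ zero    (suc _) = 0
δ (suc _) zero    = 0
δ (suc i) (suc j) = δ i j

δ-refl : ∀ {N} (i : Fin N) → δ i i ≡ 1
δ-refl zero    = refl
δ-refl (suc i) = δ-refl i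

∑-*-δ : ∀ {N} (f : Fin N → ℕ) j → ∑[ i < N ] (f i * δ i j) ≡ f j
∑-*-δ {suc N} f zero = begin
  f zero * 1 + ∑[ i < N ] (f (suc i) * 0) ≡⟨ cong₂ _+_ (*-identityʳ (f zero)) (sum-cong-≗ (*-zeroʳ ∘ f ∘ suc)) ⟩
  f zero + ∑[ i < N ] 0                   ≡⟨ cong (f zero +_) (sum-replicate-zero N) ⟩
  f zero + 0                              ≡⟨ +-identityʳ (f zero) ⟩
  f zero                                  ∎
  where open ≡-Reasoning
∑-*-δ {suc N} f (suc j) = cong₂ _+_ (*-zeroʳ (f zero)) (∑-*-δ (f ∘ suc) j)

multiplicity : ∀ {N} → List (Fin N) → Fin N → ℕ
multiplicity []       i = 0
multiplicity (p ∷ ps) i = δ i p + multiplicity ps i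

∑-*-multiplicity : ∀ {N} (f : Fin N → ℕ) ps → ∑[ i < N ] (f i * multiplicity ps i) ≡ sum (map f ps)
∑-*-multiplicity {N} f []       = trans (sum-cong-≗ (*-zeroʳ ∘ f)) (sum-replicate-zero N)
∑-*-multiplicity {N} f (p ∷ ps) = begin
  ∑[ i < N ] (f i * (δ i p + multiplicity ps i))
    ≡⟨ sum-cong-≗ (λ i → *-distribˡ-+ (f i) (δ i p) (multiplicity ps i)) ⟩
  ∑[ i < N ] (f i * δ i p + f i * multiplicity ps i)
    ≡⟨ ∑-distrib-+ (λ i → f i * δ i p) (λ i → f i * multiplicity ps i) ⟩
  ∑[ i < N ] (f i * δ i p) + ∑[ i < N ] (f i * multiplicity ps i)
    ≡⟨ cong₂ _+_ (∑-*-δ f p) (∑-*-multiplicity f ps) ⟩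
  f p + sum (map f ps) ∎
  where open ≡-Reasoning

multiplicity-replicate-++ : ∀ {N} k (i : Fin N) ps → k ≤ multiplicity (replicate k i ++ ps) i
multiplicity-replicate-++ zero    i ps = z≤n
multiplicity-replicate-++ (suc k) i ps rewrite δ-refl i = s≤s (multiplicity-replicate-++ k i ps)

∃-boundedParts : ∀ N t q → q ≤ N * t →
  Σ[ ps ∈ List (Fin N) ] sum (map (suc ∘ toℕ) ps) ≡ q × length ps ≤ t
∃-boundedParts N zero q q≤N*0 = [] , sym (n≤0⇒n≡0 (≤-trans q≤N*0 (≤-reflexive (*-zeroʳ N)))) , z≤n
∃-boundedParts N (suc t) zero _ = [] , refl , z≤n
∃-boundedParts (suc N) (suc t) (suc q) q<N*t with q ≤? N
... | yes q≤N = fromℕ< (s≤s q≤N) ∷ [] , cong suc (trans (+-identityʳ _) (toℕ-fromℕ< (s≤s q≤N))) , s≤s z≤n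
... | no  q≰N
  with ps , Σps≡q∸N , ∣ps∣≤t ← ∃-boundedParts (suc N) t (q ∸ N)
         (m≤n+o⇒m∸n≤o q N (s≤s⁻¹ (≤-trans q<N*t (≤-reflexive (*-suc (suc N) t))))) =
  fromℕ N ∷ ps , cong suc (trans (cong₂ _+_ (toℕ-fromℕ N) Σps≡q∸N) (m+[n∸m]≡n (≰⇒≥ q≰N))) , s≤s ∣ps∣≤t

feasible : ∀ m n r {s q} → 0 < n ^ (m ∸ r) →
  q + s * n ^ (m ∸ r) ≤ n ^ r * n ^ (m ∸ r) → s + q ≤ (m C r) * s → Feasible m n r (s + q)
feasible m n r {s} {q} N>0 q+s*N≤R*N s+q≤C*s =
  x , sym weighted , total , i₀ , toℕ-fromℕ< N>0 ,
  ≤-trans s+q≤C*s (*-monoʳ-≤ (m C r) (multiplicity-replicate-++ s i₀ ps))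
  where
  open ≤-Reasoning
  N R : ℕ
  N = n ^ (m ∸ r)
  R = n ^ r
  instance _ = >-nonZero N>0

  s≤R : s ≤ R
  s≤R = *-cancelʳ-≤ s R N (m+n≤o⇒n≤o q q+s*N≤R*N)

  q≤N*[R∸s] : q ≤ N * (R ∸ s)
  q≤N*[R∸s] = begin
    q             ≤⟨ m+n≤o⇒m≤o∸n q q+s*N≤R*N ⟩
    R * N ∸ s * N ≡⟨ *-distribʳ-∸ N R s ⟨
    (R ∸ s) * N   ≡⟨ *-comm (R ∸ s) N ⟩
    N * (R ∸ s)   ∎

  i₀ : Fin N
  i₀ = fromℕ< N>0

  parts : Σ[ ps ∈ List (Fin N) ] sum (map (suc ∘ toℕ) ps) ≡ q × length ps ≤ R ∸ s
  parts = ∃-boundedParts N (R ∸ s) q q≤N*[R∸s]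

  ps all : List (Fin N)
  ps  = proj₁ parts
  all = replicate s i₀ ++ ps

  x : Fin N → ℕ
  x = multiplicity all

  weighted : sum (map (λ i → suc (toℕ i) * x i) (allFin N)) ≡ s + q
  weighted = begin-equality
    sum (map (λ i → suc (toℕ i) * x i) (allFin N))
      ≡⟨ sum-map-allFin (λ i → suc (toℕ i) * x i) ⟩
    ∑[ i < N ] (suc (toℕ i) * x i)
      ≡⟨ ∑-*-multiplicity (suc ∘ toℕ) all ⟩
    sum (map (suc ∘ toℕ) all)
      ≡⟨ cong sum (map-++ (suc ∘ toℕ) (replicate s i₀) ps) ⟩
    sum (map (suc ∘ toℕ) (replicate s i₀) ++ map (suc ∘ toℕ) ps)
      ≡⟨ sum-++ (map (suc ∘ toℕ) (replicate s i₀)) _ ⟩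
    sum (map (suc ∘ toℕ) (replicate s i₀)) + sum (map (suc ∘ toℕ) ps)
      ≡⟨ cong₂ _+_ (trans (cong sum (map-replicate (suc ∘ toℕ) s i₀)) (sum-replicate s _)) (proj₁ (proj₂ parts)) ⟩
    s * suc (toℕ i₀) + q
      ≡⟨ cong (λ k → s * suc k + q) (toℕ-fromℕ< N>0) ⟩
    s * 1 + q
      ≡⟨ cong (_+ q) (*-identityʳ s) ⟩
    s + q ∎

  total : sum (map x (allFin N)) ≤ R
  total = begin
    sum (map x (allFin N))              ≡⟨ sum-map-allFin x ⟩
    ∑[ i < N ] x i                      ≡⟨ sum-cong-≗ (λ i → *-identityˡ (x i)) ⟨
    ∑[ i < N ] (1 * x i)                ≡⟨ ∑-*-multiplicity (λ _ → 1) all ⟩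
    sum (map (λ _ → 1) all)             ≡⟨ sum-map-const-1 all ⟩
    length all                          ≡⟨ length-++ (replicate s i₀) ⟩
    length (replicate s i₀) + length ps ≤⟨ +-mono-≤ (≤-reflexive (length-replicate s)) (proj₂ (proj₂ parts)) ⟩
    s + (R ∸ s)                         ≡⟨ m+[n∸m]≡n s≤R ⟩
    R                                   ∎

module _ {m n : ℕ} (A : List (Fun m n)) where

  DeterminedBy : Subset m → Fun m n → Set
  DeterminedBy T f = All (λ g → restrict T g ≡ restrict T f → g ≡ f) A

  determinedBy? : ∀ T → Decidable (DeterminedBy T)
  determinedBy? T f = All.all? (λ g → ≡-dec _≟_ (restrict T g) (restrict T f) →-dec ≡-dec _≟_ g f) A

  determined undetermined : Subset m → List (Fun m n)
  determined   T = filter (determinedBy? T) A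
  undetermined T = filter (∁? (determinedBy? T)) A

  ∈-determined⁻ : ∀ T {f} → f ∈ determined T → f ∈ A × DeterminedBy T f
  ∈-determined⁻ T = ∈-filter⁻ (determinedBy? T) {xs = A}

  ∈-undetermined⁻ : ∀ T {f} → f ∈ undetermined T → f ∈ A × ¬ DeterminedBy T f
  ∈-undetermined⁻ T = ∈-filter⁻ (∁? (determinedBy? T)) {xs = A}

  occam⇒determinedBy : ∀ {S T f} → Occam A S f → S ⊆ₛ T → DeterminedBy T f
  occam⇒determinedBy {T = T} (_ , least) S⊆T =
    All.tabulate (λ {g} g∈A eq → sym (least g g∈A (λ x x∈S → restrict-agrees T eq x (S⊆T x∈S))))

  ∃-determining-subsetOfSize : ∀ {r f} → r ≤ m → RadiusAtMost A f r →
    ∃[ T ] T ∈ subsetsOfSize m r × DeterminedBy T f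
  ∃-determining-subsetOfSize r≤m (S , occam , ∣S∣≤r)
    with T , S⊆T , ∣T∣≡r ← ∃-⊇-ofSize S ∣S∣≤r r≤m =
    T , ∈-subsetsOfSize⁺ T ∣T∣≡r , occam⇒determinedBy occam S⊆T

  ∃-large-determined : ∀ {r} → r ≤ m → (∀ f → f ∈ A → RadiusAtMost A f r) →
    ∃[ T ] ∣ T ∣ ≡ r × length A ≤ (m C r) * length (determined T)
  ∃-large-determined {r} r≤m radius≤r
    with T , T∈ks , ∣A∣≤∣ks∣*s ← ∃-large-class determinedBy? (subsetsOfSize m r) A
           (proj₂ (∃-∈-subsetsOfSize r≤m)) (λ {f} f∈A → ∃-determining-subsetOfSize r≤m (radius≤r f f∈A))
    = T , ∈-subsetsOfSize⁻ T∈ks , subst (λ c → length A ≤ c * length (determined T)) (length-subsetsOfSize m r) ∣A∣≤∣ks∣*s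

  -- The pairs (f|T, f|∁T) for undetermined f, and (g|T, ρ) for determined g and arbitrary ρ,
  -- are pairwise distinct: an undetermined f shares its restriction to T with no determined g.
  determined-counting : Unique A → ∀ T →
    length (undetermined T) + length (determined T) * n ^ ∣ ∁ T ∣ ≤ n ^ ∣ T ∣ * n ^ ∣ ∁ T ∣
  determined-counting A! T = begin
    length W + length V * n ^ ∣ ∁ T ∣       ≡⟨ length-L ⟨
    length L                                ≤⟨ unique∧⊆⇒length≤ L! L⊆allPairs ⟩
    length allPairs                         ≡⟨ length-cartesianProductWith _,_ (allVecs ∣ T ∣) (allVecs ∣ ∁ T ∣) ⟩
    length (allVecs ∣ T ∣) * length (allVecs ∣ ∁ T ∣)
                                            ≡⟨ cong₂ _*_ (length-allVecs ∣ T ∣) (length-allVecs ∣ ∁ T ∣) ⟩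
    n ^ ∣ T ∣ * n ^ ∣ ∁ T ∣                 ∎
    where
    open ≤-Reasoning
    V W : List (Fun m n)
    V = determined T
    W = undetermined T

    Pair : Set
    Pair = Vec (Fin n) ∣ T ∣ × Vec (Fin n) ∣ ∁ T ∣

    split : Fun m n → Pair
    split f = restrict T f , restrict (∁ T) f

    L allPairs : List Pair
    L        = map split W ++ cartesianProduct (map (restrict T) V) (allVecs ∣ ∁ T ∣)
    allPairs = cartesianProduct (allVecs ∣ T ∣) (allVecs ∣ ∁ T ∣)

    length-L : length L ≡ length W + length V * n ^ ∣ ∁ T ∣
    length-L = begin-equality
      length L ≡⟨ length-++ (map split W) ⟩
      length (map split W) + length (cartesianProduct (map (restrict T) V) (allVecs ∣ ∁ T ∣))
        ≡⟨ cong₂ _+_ (length-map split W)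
                     (length-cartesianProductWith _,_ (map (restrict T) V) (allVecs ∣ ∁ T ∣)) ⟩
      length W + length (map (restrict T) V) * length (allVecs ∣ ∁ T ∣)
        ≡⟨ cong₂ (λ a b → length W + a * b) (length-map (restrict T) V) (length-allVecs ∣ ∁ T ∣) ⟩
      length W + length V * n ^ ∣ ∁ T ∣ ∎

    V-restrictions! : Unique (map (restrict T) V)
    V-restrictions! = map⁺-injectiveOn (filter⁺ (determinedBy? T) A!)
      (λ v∈V v′∈V → All.lookup (proj₂ (∈-determined⁻ T v′∈V)) (proj₁ (∈-determined⁻ T v∈V)))

    disjoint : Disjoint (map split W) (cartesianProduct (map (restrict T) V) (allVecs ∣ ∁ T ∣))
    disjoint (p∈W , p∈V×R)
      with w , w∈W , refl ← ∈-map⁻ split p∈W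
      with w|T∈V , _ ← ∈-cartesianProduct⁻ (map (restrict T) V) (allVecs ∣ ∁ T ∣) p∈V×R
      with v , v∈V , w|T≡v|T ← ∈-map⁻ (restrict T) w|T∈V
      with w∈A , ¬w-determined ← ∈-undetermined⁻ T w∈W
      with _ , v-determined ← ∈-determined⁻ T v∈V
      with refl ← All.lookup v-determined w∈A w|T≡v|T
      = ¬w-determined v-determined

    L! : Unique L
    L! = ++⁺ (map⁺ (λ eq → restrict-∁-injective T (cong proj₁ eq) (cong proj₂ eq))
                    (filter⁺ (∁? (determinedBy? T)) A!))
             (cartesianProduct⁺ V-restrictions! (allVecs⁺ ∣ ∁ T ∣))
             disjoint

    L⊆allPairs : L ⊆ allPairs
    L⊆allPairs {a , b} _ = ∈-cartesianProduct⁺ (∈-allVecs a) (∈-allVecs b)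

theorem1p1 : (m n r : ℕ) → 0 < m → 0 < n → 0 < r → r ≤ m →
    (A : List (Fun m n)) → Unique A →
    (∀ f → f ∈ A → RadiusAtMost A f r) →
    Σ ℕ λ p → Feasible m n r p × (length A ≤ p)
theorem1p1 m n r _ n>0 _ r≤m A A! radius≤r
  with T , ∣T∣≡r , ∣A∣≤C*s ← ∃-large-determined A r≤m radius≤r =
  s + q , feasible m n r (m^n>0 n (m ∸ r)) counted (subst (_≤ (m C r) * s) (sym s+q≡∣A∣) ∣A∣≤C*s) ,
  ≤-reflexive (sym s+q≡∣A∣)
  where
  instance _ = >-nonZero n>0
  s q : ℕ
  s = length (determined A T)
  q = length (undetermined A T)

  s+q≡∣A∣ : s + q ≡ length A
  s+q≡∣A∣ = length-filter+length-filter-∁ (determinedBy? A T) A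

  counted : q + s * n ^ (m ∸ r) ≤ n ^ r * n ^ (m ∸ r)
  counted = subst₂ (λ t c → q + s * n ^ c ≤ n ^ t * n ^ c)
    ∣T∣≡r (trans (∣∁p∣≡n∸∣p∣ T) (cong (m ∸_) ∣T∣≡r)) (determined-counting A A! T)
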